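{- Let $v$ be a vertex of eligible tenacity $t$, let $p$ be a $\mathrm{minlevel}(v)$ path, and let $b=F(p,v)$. Let $u$ be a vertex on $p[b\text{ to }v]$ with $\mathrm{t}(u)<t$, and assume that an edge $(u,w)$ lies on $p$ with $w$ higher than $u$ on $p$ and $\mathrm{t}(w)=t$. Then $u$ is BFS-honest with respect to $p$.
   Context: $G=(V,E)$ is a finite undirected graph and $M$ a matching; edges in $M$ are matched, others unmatched; a vertex is unmatched if no matched edge is incident to it. An alternating path is a simple path alternating between matched and unmatched edges; $l_m$ is the minimum length of an alternating path joining two distinct unmatched vertices ($\infty$ if none). $\mathrm{evenlevel}(v)$ ($\mathrm{oddlevel}(v)$) is the length of a minimum even (odd) length alternating path from some unmatched vertex to $v$ ($\infty$ if none); such a path is an $\mathrm{evenlevel}(v)$ ($\mathrm{oddlevel}(v)$) path. $\mathrm{minlevel}(v)$ is the smaller of the two, and a $\mathrm{minlevel}(v)$ path is an evenlevel$(v)$ or oddlevel$(v)$ path of length $\mathrm{minlevel}(v)$. Tenacity $\mathrm{t}(v)=\mathrm{evenlevel}(v)+\mathrm{oddlevel}(v)$; $t_m$ is the minimum tenacity of a vertex; an odd $t$ with $t_m\le t<l_m$ is eligible. For a path $p$ starting at unmatched $f$ and vertices on it, a vertex is higher than another if it is farther from $f$ along $p$; $p[x\text{ to }y]$ denotes subpaths. For $v$ of eligible tenacity $t$ and $p$ an evenlevel$(v)$ or oddlevel$(v)$ path, $F(p,v)$ is the highest vertex on $p$ of tenacity $>t$. A vertex $u$ on $p$ is BFS-honest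 w.r.t. $p$ if $|p[f\text{ to }u]|$ equals $\mathrm{evenlevel}(u)$ if this length is even and $\mathrm{oddlevel}(u)$ if it is odd. -}

module Defs where

open import Data.Nat using (ℕ; zero; suc; _+_; _≤_; _<_; _⊔_; _⊓_)
open import Data.Nat.Divisibility using (_∣_)
open import Data.Fin using (Fin; zero; suc; toℕ; inject₁; fromℕ; _≤_)
  renaming (_<_ to _<ᶠ_)
open import Data.Bool using (Bool; true; false)
open import Data.Product using (Σ; ∃; ∃-syntax; _×_; _,_)
open import Data.Sum using (_⊎_)
open import Relation.Nullary using (¬_)
open import Relation.Binary.PropositionalEquality using (_≡_; _≢_)
open import Function.Definitions using (Injective)

-- Extended naturals (∞ for "no such path")

data ℕ∞ : Set where
  fin : ℕ → ℕ∞
  ∞   : ℕ∞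

_+∞_ : ℕ∞ → ℕ∞ → ℕ∞
fin a +∞ fin b = fin (a + b)
_     +∞ _     = ∞

min∞ : ℕ∞ → ℕ∞ → ℕ∞
min∞ (fin a) (fin b) = fin (a ⊓ b)
min∞ (fin a) ∞       = fin a
min∞ ∞       y       = y

_<∞_ : ℕ → ℕ∞ → Set
a <∞ fin b = a < b
a <∞ ∞     = Data.Unit.⊤ where import Data.Unit

Even : ℕ → Set
Even k = 2 ∣ k

Odd : ℕ → Set
Odd k = ¬ Even k

record Graph (n : ℕ) : Set where
  field
    adj       : Fin n → Fin n → Bool
    adj-sym   : ∀ x y → adj x y ≡ adj y x
    adj-irrefl : ∀ x → adj x x ≡ false

record Matching {n : ℕ} (G : Graph n) : Set where
  field
    matched       : Fin n → Fin n → Bool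
    matched⊆adj   : ∀ x y → matched x y ≡ true → Graph.adj G x y ≡ true
    matched-sym   : ∀ x y → matched x y ≡ matched y x
    matched-unique : ∀ x y z → matched x y ≡ true → matched x z ≡ true → y ≡ z

module _ {n : ℕ} (G : Graph n) (M : Matching G) where
  open Graph G
  open Matching M

  Unmatched : Fin n → Set
  Unmatched x = ∀ y → matched x y ≡ false

  -- A path with L edges is a map from positions 0..L to vertices;
  -- position 0 is the start f, and larger positions are "higher".
  -- Edge i (i : Fin L) joins positions i and i+1.
  IsAltPath : (L : ℕ) → (Fin (suc L) → Fin n) → Set
  IsAltPath L p =
      Injective _≡_ _≡_ p
    × (∀ (i : Fin L) → adj (p (inject₁ i)) (p (suc i)) ≡ true)
    × (∀ (i j : Fin L) → toℕ j ≡ suc (toℕ i) →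
         matched (p (inject₁ i)) (p (suc i)) ≢ matched (p (inject₁ j)) (p (suc j)))

  FreeAltPath : (L : ℕ) → (Fin (suc L) → Fin n) → Fin n → Set
  FreeAltPath L p v = IsAltPath L p × Unmatched (p zero) × p (fromℕ L) ≡ v

  EvenLevel : Fin n → ℕ∞ → Set
  EvenLevel v (fin k) =
      Even k
    × (Σ (Fin (suc k) → Fin n) λ p → FreeAltPath k p v)
    × (∀ L p → FreeAltPath L p v → Even L → k Data.Nat.≤ L)
  EvenLevel v ∞ = ∀ L p → FreeAltPath L p v → ¬ Even L

  OddLevel : Fin n → ℕ∞ → Set
  OddLevel v (fin k) =
      Odd k
    × (Σ (Fin (suc k) → Fin n) λ p → FreeAltPath k p v)
    × (∀ L p → FreeAltPath L p v → Odd L → k Data.Nat.≤ L)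
  OddLevel v ∞ = ∀ L p → FreeAltPath L p v → ¬ Odd L

  MinLevel : Fin n → ℕ∞ → Set
  MinLevel v x = ∃[ e ] ∃[ o ] (EvenLevel v e × OddLevel v o × x ≡ min∞ e o)

  Tenacity : Fin n → ℕ∞ → Set
  Tenacity v x = ∃[ e ] ∃[ o ] (EvenLevel v e × OddLevel v o × x ≡ e +∞ o)

  -- t_m ≤ t  (t_m = minimum tenacity of a vertex)
  TmAtMost : ℕ → Set
  TmAtMost t = ∃[ x ] ∃[ s ] (Tenacity x (fin s) × s Data.Nat.≤ t)

  -- t < l_m  (l_m = min length of an alternating path joining two
  -- distinct unmatched vertices, ∞ if none)
  BelowLm : ℕ → Set
  BelowLm t = ∀ L (p : Fin (suc L) → Fin n) → IsAltPath L p →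
    Unmatched (p zero) → Unmatched (p (fromℕ L)) → p zero ≢ p (fromℕ L) → t < L

  Eligible : ℕ → Set
  Eligible t = Odd t × TmAtMost t × BelowLm t

  MinLevelPath : (L : ℕ) → (Fin (suc L) → Fin n) → Fin n → Set
  MinLevelPath L p v = FreeAltPath L p v × MinLevel v (fin L)

  TenGt : Fin n → ℕ → Set
  TenGt x t = ∃[ s ] (Tenacity x s × t <∞ s)

  TenLt : Fin n → ℕ → Set
  TenLt x t = ∃[ s ] (Tenacity x (fin s) × s < t)

  IsF : (L : ℕ) → (Fin (suc L) → Fin n) → ℕ → Fin (suc L) → Set
  IsF L p t b = TenGt (p b) t × (∀ (i : Fin (suc L)) → b <ᶠ i → ¬ TenGt (p i) t)

  BFSHonest : (L : ℕ) → (Fin (suc L) → Fin n) → Fin (suc L) → Set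
  BFSHonest L p i = (Even (toℕ i) → EvenLevel (p i) (fin (toℕ i)))
                  × (Odd (toℕ i) → OddLevel (p i) (fin (toℕ i)))

-- Write u = p(K) and w = p(K+1). Suppose an alternating path q from an unmatched vertex reaches u
-- in a < K steps, with a ≡ K mod 2, and let q(c) = p(r) be the first vertex of q on p[K..L].
-- If c ≡ r mod 2, then q[0..c] followed by p[r..L] reaches v in c + (L - r) < L steps, against
-- minlevel(v) = L. Otherwise r > K, and q[0..c] followed by p[r..K+1] backwards reaches w with the
-- parity opposite to that of p[0..K+1]; hence t(w) ≤ c + r < 2L ≤ t(v) = t(w).
module Submission where

open import Defs
open import Data.Nat using (ℕ; suc; _≤_)
open import Data.Fin using (Fin; inject₁; toℕ) renaming (suc to fsuc)
open import Relation.Binary.PropositionalEquality using (_≡_)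

open import Data.Bool using (Bool; true; false; not; _xor_) renaming (_≟_ to _≟ᵇ_)
open import Data.Bool.Properties using (not-involutive; not-distribˡ-xor; xor-same; xor-identityʳ; ¬-not; not-¬)
open import Data.Empty using (⊥)
open import Data.Fin using (fromℕ; fromℕ<) renaming (_≟_ to _≟ᶠ_)
open import Data.Fin.Properties using (toℕ-injective; toℕ<n; toℕ≤pred[n]; toℕ-inject₁; toℕ-fromℕ; toℕ-fromℕ<)
open import Data.Nat using (zero; _+_; _*_; _∸_; _<_; _≤?_; _<?_; z≤n; s≤s; s≤s⁻¹)
open import Data.Nat.Divisibility using (divides; _∣?_; _∣0; ∣-refl; ∣m∣n⇒∣m+n)
open import Data.Nat.Induction using (<-rec)
open import Data.Nat.Properties
open import Data.Nat.Tactic.RingSolver using (solve-∀)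
open import Data.Product using (∃; _×_; _,_; proj₁; proj₂)
open import Data.Sum using (_⊎_; inj₁; inj₂)
open import Function using (_∘_)
open import Relation.Binary.PropositionalEquality
  using (refl; sym; trans; cong; cong₂; subst; _≢_; ≢-sym; module ≡-Reasoning)
open import Relation.Nullary using (¬_; yes; no; contradiction)
open import Relation.Nullary.Decidable using (_×-dec_)
open import Relation.Unary using (Decidable)

parity : ℕ → Bool
parity zero    = false
parity (suc n) = not (parity n)

parity-+ : ∀ m n → parity (m + n) ≡ parity m xor parity n
parity-+ zero    n = refl
parity-+ (suc m) n = trans (cong not (parity-+ m n)) (not-distribˡ-xor (parity m) (parity n))

parity[n+n]≡false : ∀ n → parity (n + n) ≡ false
parity[n+n]≡false n = trans (parity-+ n n) (xor-same (parity n))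

parity-+-≢ : ∀ {m n} → parity m ≢ parity n → parity (m + n) ≡ true
parity-+-≢ {m} {n} m≢n = begin
  parity (m + n)              ≡⟨ parity-+ m n ⟩
  parity m xor parity n       ≡⟨ cong (_xor parity n) (¬-not m≢n) ⟩
  not (parity n) xor parity n ≡⟨ sym (not-distribˡ-xor (parity n) (parity n)) ⟩
  not (parity n xor parity n) ≡⟨ cong not (xor-same (parity n)) ⟩
  true                        ∎
  where open ≡-Reasoning

even⇒parity≡false : ∀ {n} → Even n → parity n ≡ false
even⇒parity≡false (divides q refl) = parity[q*2] q
  where
  parity[q*2] : ∀ q → parity (q * 2) ≡ false
  parity[q*2] zero    = refl
  parity[q*2] (suc q) = trans (not-involutive _) (parity[q*2] q)

parity≡false⇒even : ∀ n → parity n ≡ false → Even n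
parity≡false⇒even zero          _  = 2 ∣0
parity≡false⇒even (suc zero)    ()
parity≡false⇒even (suc (suc n)) eq =
  ∣m∣n⇒∣m+n ∣-refl (parity≡false⇒even n (trans (sym (not-involutive _)) eq))

odd⇒parity≡true : ∀ {n} → Odd n → parity n ≡ true
odd⇒parity≡true {n} odd = ¬-not (odd ∘ parity≡false⇒even n)

parity≡true⇒odd : ∀ {n} → parity n ≡ true → Odd n
parity≡true⇒odd eq even with () ← trans (sym eq) (even⇒parity≡false even)

alternating⇒parity : ∀ {L} (s : ℕ → Bool) → (0 < L → s 0 ≡ false) →
  (∀ {i} → suc i < L → s i ≢ s (suc i)) → ∀ {i} → i < L → s i ≡ parity i
alternating⇒parity s start step {zero}  i<L = start i<L
alternating⇒parity s start step {suc i} i<L =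
  trans (¬-not (≢-sym (step i<L))) (cong not (alternating⇒parity s start step (<-trans (n<1+n i) i<L)))

least-witness : ∀ {P : ℕ → Set} → Decidable P → ∀ {a} → P a →
  ∃ λ c → c ≤ a × P c × (∀ {x} → x < c → ¬ P x)
least-witness {P} P? {a} = <-rec (λ a → P a → _) search a
  where
  search : ∀ a → (∀ {b} → b < a → P b → ∃ λ c → c ≤ b × P c × (∀ {x} → x < c → ¬ P x)) →
    P a → ∃ λ c → c ≤ a × P c × (∀ {x} → x < c → ¬ P x)
  search a rec pa with anyUpTo? P? a
  ... | no none = a , ≤-refl , pa , λ x<a px → none (_ , x<a , px)
  ... | yes (b , b<a , pb) with rec b<a pb
  ...   | c , c≤b , pc , first = c , ≤-trans c≤b (<⇒≤ b<a) , pc , first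

splice : ∀ {A : Set} → ℕ → (ℕ → A) → (ℕ → A) → ℕ → A
splice zero    g h x       = h x
splice (suc c) g h zero    = g zero
splice (suc c) g h (suc x) = splice c (g ∘ suc) h x

splice-≤ : ∀ {A : Set} c (g h : ℕ → A) → h 0 ≡ g c → ∀ {x} → x ≤ c → splice c g h x ≡ g x
splice-≤ zero    g h join {zero}  _         = join
splice-≤ (suc c) g h join {zero}  _         = refl
splice-≤ (suc c) g h join {suc x} (s≤s x≤c) = splice-≤ c (g ∘ suc) h join x≤c

splice-+ : ∀ {A : Set} c (g h : ℕ → A) j → splice c g h (c + j) ≡ h j
splice-+ zero    g h j = refl
splice-+ (suc c) g h j = splice-+ c (g ∘ suc) h j

i<c⊎∃[j]c+j≡i : ∀ c i → i < c ⊎ ∃ λ j → c + j ≡ i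
i<c⊎∃[j]c+j≡i c i with i <? c
... | yes i<c = inj₁ i<c
... | no  i≮c = inj₂ (m≤n⇒∃[o]m+o≡n (≮⇒≥ i≮c))

-- Turns a path on positions Fin (suc L) into a function on ℕ; positions beyond L are sent to L.
clamp : (L : ℕ) → ℕ → Fin (suc L)
clamp L x = fromℕ< (s≤s (m⊓n≤n x L))

toℕ-clamp : ∀ {L x} → x ≤ L → toℕ (clamp L x) ≡ x
toℕ-clamp x≤L = trans (toℕ-fromℕ< _) (m≤n⇒m⊓n≡m x≤L)

clamp-toℕ : ∀ {L} (i : Fin (suc L)) → clamp L (toℕ i) ≡ i
clamp-toℕ i = toℕ-injective (toℕ-clamp (toℕ≤pred[n] i))

clamp-inject₁ : ∀ {L j} (j<L : j < L) → clamp L j ≡ inject₁ (fromℕ< j<L)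
clamp-inject₁ j<L =
  toℕ-injective (trans (toℕ-clamp (<⇒≤ j<L)) (sym (trans (toℕ-inject₁ _) (toℕ-fromℕ< j<L))))

clamp-suc : ∀ {L j} (j<L : j < L) → clamp L (suc j) ≡ fsuc (fromℕ< j<L)
clamp-suc j<L = toℕ-injective (trans (toℕ-clamp j<L) (cong suc (sym (toℕ-fromℕ< j<L))))

clamp-fromℕ : ∀ L → clamp L L ≡ fromℕ L
clamp-fromℕ L = toℕ-injective (trans (toℕ-clamp ≤-refl) (sym (toℕ-fromℕ L)))

module _ {n : ℕ} (G : Graph n) (M : Matching G) where
  open Graph G
  open Matching M

  record AltSegment (o len : ℕ) (g : ℕ → Fin n) : Set where
    field
      injective  : ∀ {x y} → x ≤ len → y ≤ len → g x ≡ g y → x ≡ y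
      adjacent   : ∀ {j} → j < len → adj (g j) (g (suc j)) ≡ true
      alternates : ∀ {j} → j < len → matched (g j) (g (suc j)) ≡ parity (o + j)
  open AltSegment

  AltPath : ℕ → (ℕ → Fin n) → Set
  AltPath len g = AltSegment 0 len g × Unmatched G M (g 0)

  take : ∀ {o len m g} → m ≤ len → AltSegment o len g → AltSegment o m g
  take m≤len S = record
    { injective  = λ x≤m y≤m → injective S (≤-trans x≤m m≤len) (≤-trans y≤m m≤len)
    ; adjacent   = λ j<m → adjacent S (<-≤-trans j<m m≤len)
    ; alternates = λ j<m → alternates S (<-≤-trans j<m m≤len)
    }

  drop : ∀ {o e g} r → AltSegment o (r + e) g → AltSegment (o + r) e (λ j → g (r + j))
  drop {o} {e} {g} r S = record
    { injective  = λ x≤e y≤e eq → +-cancelˡ-≡ r _ _ (injective S (+-monoʳ-≤ r x≤e) (+-monoʳ-≤ r y≤e) eq)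
    ; adjacent   = λ {j} j<e →
        subst (λ k → adj (g (r + j)) (g k) ≡ true) (sym (+-suc r j)) (adjacent S (+-monoʳ-< r j<e))
    ; alternates = λ {j} j<e →
        trans (subst (λ k → matched (g (r + j)) (g k) ≡ parity (o + (r + j))) (sym (+-suc r j))
                     (alternates S (+-monoʳ-< r j<e)))
              (cong parity (sym (+-assoc o r j)))
    }

  reverse : ∀ {o len g} → AltSegment o len g → AltSegment (suc (o + len)) len (λ j → g (len ∸ j))
  reverse {o} {len} {g} S = record
    { injective  = λ {x} {y} x≤len y≤len eq →
        ∸-cancelˡ-≡ x≤len y≤len (injective S (m∸n≤m len x) (m∸n≤m len y) eq)
    ; adjacent   = λ j<len → trans (cong₂ adj (cong g (step j<len)) refl)
                                   (trans (adj-sym _ _) (adjacent S (below j<len)))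
    ; alternates = λ {j} j<len → trans (cong₂ matched (cong g (step j<len)) refl)
                                   (trans (matched-sym _ _) (trans (alternates S (below j<len)) (offset j<len)))
    }
    where
    step : ∀ {j} → j < len → len ∸ j ≡ suc (len ∸ suc j)
    step j<len = +-∸-assoc 1 j<len
    below : ∀ {j} → j < len → len ∸ suc j < len
    below {j} j<len = subst (_≤ len) (step j<len) (m∸n≤m len j)
    -- o + (len ∸ suc j) and suc (o + len) + j differ by 2 (suc j).
    offset : ∀ {j} → j < len → parity (o + (len ∸ suc j)) ≡ parity (suc (o + len) + j)
    offset {j} j<len = begin
      parity (o + m)                           ≡⟨ sym (xor-identityʳ _) ⟩
      parity (o + m) xor false                 ≡⟨ cong (parity (o + m) xor_) (sym (parity[n+n]≡false (suc j))) ⟩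
      parity (o + m) xor parity (suc j + suc j) ≡⟨ sym (parity-+ (o + m) (suc j + suc j)) ⟩
      parity ((o + m) + (suc j + suc j))        ≡⟨ cong parity (shuffle o m j) ⟩
      parity (suc (o + (m + suc j)) + j)        ≡⟨ cong (λ k → parity (suc (o + k) + j)) (m∸n+n≡m j<len) ⟩
      parity (suc (o + len) + j)                ∎
      where
      open ≡-Reasoning
      m = len ∸ suc j
      shuffle : ∀ o m j → (o + m) + (suc j + suc j) ≡ suc (o + (m + suc j)) + j
      shuffle = solve-∀

  reoffset : ∀ {o o′ len g} → parity o ≡ parity o′ → AltSegment o len g → AltSegment o′ len g
  reoffset {o} {o′} o≡o′ S = record
    { injective  = injective S
    ; adjacent   = adjacent S
    ; alternates = λ {j} j<len → trans (alternates S j<len)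
        (trans (parity-+ o j) (trans (cong (_xor parity j) o≡o′) (sym (parity-+ o′ j))))
    }

  splice-AltSegment : ∀ {o c len g h} → AltSegment o c g → AltSegment (o + c) len h → h 0 ≡ g c →
    (∀ {x j} → x < c → j ≤ len → g x ≢ h j) → AltSegment o (c + len) (splice c g h)
  splice-AltSegment {o} {c} {len} {g} {h} S T join disjoint = record
    { injective = inj ; adjacent = adj′ ; alternates = alt }
    where
    low : ∀ {x} → x ≤ c → splice c g h x ≡ g x
    low = splice-≤ c g h join
    high : ∀ j → splice c g h (c + j) ≡ h j
    high = splice-+ c g h
    high-suc : ∀ j → splice c g h (suc (c + j)) ≡ h (suc j)
    high-suc j = trans (cong (splice c g h) (sym (+-suc c j))) (high (suc j))
    adj′ : ∀ {i} → i < c + len → adj (splice c g h i) (splice c g h (suc i)) ≡ true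
    adj′ {i} i< with i<c⊎∃[j]c+j≡i c i
    ... | inj₁ i<c = trans (cong₂ adj (low (<⇒≤ i<c)) (low i<c)) (adjacent S i<c)
    ... | inj₂ (j , refl) = trans (cong₂ adj (high j) (high-suc j)) (adjacent T (+-cancelˡ-< c j len i<))
    alt : ∀ {i} → i < c + len → matched (splice c g h i) (splice c g h (suc i)) ≡ parity (o + i)
    alt {i} i< with i<c⊎∃[j]c+j≡i c i
    ... | inj₁ i<c = trans (cong₂ matched (low (<⇒≤ i<c)) (low i<c)) (alternates S i<c)
    ... | inj₂ (j , refl) = trans (cong₂ matched (high j) (high-suc j))
                              (trans (alternates T (+-cancelˡ-< c j len i<)) (cong parity (+-assoc o c j)))
    inj : ∀ {x y} → x ≤ c + len → y ≤ c + len → splice c g h x ≡ splice c g h y → x ≡ y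
    inj {x} {y} x≤ y≤ eq with i<c⊎∃[j]c+j≡i c x | i<c⊎∃[j]c+j≡i c y
    ... | inj₁ x<c | inj₁ y<c =
      injective S (<⇒≤ x<c) (<⇒≤ y<c) (trans (sym (low (<⇒≤ x<c))) (trans eq (low (<⇒≤ y<c))))
    ... | inj₁ x<c | inj₂ (j , refl) =
      contradiction (trans (sym (low (<⇒≤ x<c))) (trans eq (high j))) (disjoint x<c (+-cancelˡ-≤ c j len y≤))
    ... | inj₂ (j , refl) | inj₁ y<c =
      contradiction (trans (sym (low (<⇒≤ y<c))) (trans (sym eq) (high j))) (disjoint y<c (+-cancelˡ-≤ c j len x≤))
    ... | inj₂ (j , refl) | inj₂ (k , refl) =
      cong (c +_) (injective T (+-cancelˡ-≤ c j len x≤) (+-cancelˡ-≤ c k len y≤)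
                    (trans (sym (high j)) (trans eq (high k))))

  splice-AltPath : ∀ {c len g h} → AltPath c g → AltSegment c len h → h 0 ≡ g c →
    (∀ {x j} → x < c → j ≤ len → g x ≢ h j) → AltPath (c + len) (splice c g h)
  splice-AltPath {c} {g = g} {h} (S , start) T join disjoint =
    splice-AltSegment S T join disjoint , subst (Unmatched G M) (sym (splice-≤ c g h join z≤n)) start

  AltPath⇒FreeAltPath : ∀ {L g v} → AltPath L g → g L ≡ v → FreeAltPath G M L (g ∘ toℕ) v
  AltPath⇒FreeAltPath {L} {g} (S , start) end = (inj , adj′ , alt) , start , trans (cong g (toℕ-fromℕ L)) end
    where
    inj : ∀ {x y : Fin (suc L)} → g (toℕ x) ≡ g (toℕ y) → x ≡ y
    inj {x} {y} eq = toℕ-injective (injective S (toℕ≤pred[n] x) (toℕ≤pred[n] y) eq)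
    at : (f : Fin n → Fin n → Bool) (e : Fin L) →
      f (g (toℕ (inject₁ e))) (g (suc (toℕ e))) ≡ f (g (toℕ e)) (g (suc (toℕ e)))
    at f e = cong (λ k → f (g k) (g (suc (toℕ e)))) (toℕ-inject₁ e)
    adj′ : ∀ (e : Fin L) → adj (g (toℕ (inject₁ e))) (g (suc (toℕ e))) ≡ true
    adj′ e = trans (at adj e) (adjacent S (toℕ<n e))
    matched-edge : ∀ (e : Fin L) → matched (g (toℕ (inject₁ e))) (g (suc (toℕ e))) ≡ parity (toℕ e)
    matched-edge e = trans (at matched e) (alternates S (toℕ<n e))
    alt : ∀ (e e′ : Fin L) → toℕ e′ ≡ suc (toℕ e) →
      matched (g (toℕ (inject₁ e))) (g (suc (toℕ e))) ≢ matched (g (toℕ (inject₁ e′))) (g (suc (toℕ e′)))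
    alt e e′ e′≡ eq =
      not-¬ refl (trans (sym (matched-edge e)) (trans eq (trans (matched-edge e′) (cong parity e′≡))))

  FreeAltPath⇒AltPath : ∀ {L p v} → FreeAltPath G M L p v → AltPath L (p ∘ clamp L)
  FreeAltPath⇒AltPath {L} {p} ((inj , adj′ , alt) , start , _) = S , start
    where
    at : (f : Fin n → Fin n → Bool) {j : ℕ} (j<L : j < L) →
      f (p (clamp L j)) (p (clamp L (suc j))) ≡ f (p (inject₁ (fromℕ< j<L))) (p (fsuc (fromℕ< j<L)))
    at f j<L = cong₂ f (cong p (clamp-inject₁ j<L)) (cong p (clamp-suc j<L))
    consecutive : ∀ {j} (j<L : j < L) (sj<L : suc j < L) → toℕ (fromℕ< sj<L) ≡ suc (toℕ (fromℕ< j<L))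
    consecutive j<L sj<L = trans (toℕ-fromℕ< sj<L) (cong suc (sym (toℕ-fromℕ< j<L)))
    S : AltSegment 0 L (p ∘ clamp L)
    S = record
      { injective  = λ x≤L y≤L eq →
          trans (sym (toℕ-clamp x≤L)) (trans (cong toℕ (inj eq)) (toℕ-clamp y≤L))
      ; adjacent   = λ j<L → trans (at adj j<L) (adj′ (fromℕ< j<L))
      ; alternates = alternating⇒parity (λ j → matched (p (clamp L j)) (p (clamp L (suc j))))
          (λ _ → start _)
          (λ {j} sj<L eq → let j<L = <-trans (n<1+n j) sj<L in
             alt (fromℕ< j<L) (fromℕ< sj<L) (consecutive j<L sj<L)
                 (trans (sym (at matched j<L)) (trans eq (at matched sj<L))))
      }

  FreeAltPath-end : ∀ {L p v} → FreeAltPath G M L p v → p (clamp L L) ≡ v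
  FreeAltPath-end {L} {p} (_ , _ , end) = trans (cong p (clamp-fromℕ L)) end

  min∞-≤ˡ : ∀ {L a o} → fin L ≡ min∞ (fin a) o → L ≤ a
  min∞-≤ˡ {o = fin b} refl = m⊓n≤m _ b
  min∞-≤ˡ {o = ∞}     refl = ≤-refl

  min∞-≤ʳ : ∀ {L e b} → fin L ≡ min∞ e (fin b) → L ≤ b
  min∞-≤ʳ {e = fin a} refl = m⊓n≤n a _
  min∞-≤ʳ {e = ∞}     refl = ≤-refl

  minLevel-≤ : ∀ {v L l q} → MinLevel G M v (fin L) → FreeAltPath G M l q v → L ≤ l
  minLevel-≤ {l = l} ml path with 2 ∣? l
  minLevel-≤ (fin a , o , (_ , _ , shortest) , _ , L≡) path | yes even = ≤-trans (min∞-≤ˡ {o = o} L≡) (shortest _ _ path even)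
  minLevel-≤ (∞     , _ , none , _ , _)               path | yes even = contradiction even (none _ _ path)
  minLevel-≤ (e , fin b , _ , (_ , _ , shortest) , L≡) path | no odd  = ≤-trans (min∞-≤ʳ {e = e} L≡) (shortest _ _ path odd)
  minLevel-≤ (_ , ∞     , _ , none , _)               path | no odd  = contradiction odd (none _ _ path)

  minLevel+minLevel≤tenacity : ∀ {v L t} → MinLevel G M v (fin L) → Tenacity G M v (fin t) → L + L ≤ t
  minLevel+minLevel≤tenacity ml (fin _ , fin _ , (_ , (_ , even) , _) , (_ , (_ , odd) , _) , refl) =
    +-mono-≤ (minLevel-≤ ml even) (minLevel-≤ ml odd)
  minLevel+minLevel≤tenacity ml (fin _ , ∞ , _ , _ , ())
  minLevel+minLevel≤tenacity ml (∞ , _ , _ , _ , ())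

  tenacity-≤ : ∀ {w t x y p q} → Tenacity G M w (fin t) → FreeAltPath G M x p w → FreeAltPath G M y q w →
    parity (x + y) ≡ true → t ≤ x + y
  tenacity-≤ (fin _ , ∞ , _ , _ , ())
  tenacity-≤ (∞ , _ , _ , _ , ())
  tenacity-≤ {x = x} {y} (fin a , fin b , (_ , _ , shortestE) , (_ , _ , shortestO) , refl) px py x+y-odd
    with parity x in ex | parity y in ey
  ... | false | true  = +-mono-≤ (shortestE _ _ px (parity≡false⇒even x ex)) (shortestO _ _ py (parity≡true⇒odd ey))
  ... | true  | false = subst (a + b ≤_) (+-comm y x)
                          (+-mono-≤ (shortestE _ _ py (parity≡false⇒even y ey)) (shortestO _ _ px (parity≡true⇒odd ex)))
  ... | false | false with () ← trans (sym x+y-odd) (trans (parity-+ x y) (cong₂ _xor_ ex ey))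
  ... | true  | true  with () ← trans (sym x+y-odd) (trans (parity-+ x y) (cong₂ _xor_ ex ey))

  shortest⇒BFSHonest : ∀ {L p} {i : Fin (suc L)} {q} → FreeAltPath G M (toℕ i) q (p i) →
    (∀ {l r} → FreeAltPath G M l r (p i) → parity l ≡ parity (toℕ i) → toℕ i ≤ l) →
    BFSHonest G M L p i
  shortest⇒BFSHonest path shortest =
      (λ even → even , (_ , path) , λ _ _ path′ even′ →
         shortest path′ (trans (even⇒parity≡false even′) (sym (even⇒parity≡false even))))
    , (λ odd → odd , (_ , path) , λ _ _ path′ odd′ →
         shortest path′ (trans (odd⇒parity≡true odd′) (sym (odd⇒parity≡true odd))))

  module _ {L K gp} (p : AltPath L gp) (K<L : K < L)
    (shortest-to-end : ∀ {l g} → AltPath l g → g l ≡ gp L → L ≤ l)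
    (long-pair : ∀ {x y g h} → AltPath x g → g x ≡ gp (suc K) → AltPath y h → h y ≡ gp (suc K) →
                 parity (x + y) ≡ true → L + L ≤ x + y)
    where

    Meets : (ℕ → Fin n) → ℕ → Set
    Meets g x = ∃ λ r → r < suc L × (K ≤ r × g x ≡ gp r)

    meets? : ∀ g → Decidable (Meets g)
    meets? g x = anyUpTo? (λ r → K ≤? r ×-dec g x ≟ᶠ gp r) (suc L)

    forward : ∀ {a c r g} → AltPath a g → c ≤ a → c < K → K ≤ r → r ≤ L → g c ≡ gp r → (∀ {x} → x < c → ¬ Meets g x) →
      parity c ≡ parity r → ⊥
    forward {c = c} {r} {g} (Q , start) c≤a c<K K≤r r≤L meet first c≡r with m≤n⇒∃[o]m+o≡n r≤L
    ... | e , r+e≡L = <⇒≱ shorter (shortest-to-end spliced end)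
      where
      tail : AltSegment c e (λ j → gp (r + j))
      tail = reoffset (sym c≡r) (drop r (subst (λ l → AltSegment 0 l gp) (sym r+e≡L) (proj₁ p)))
      spliced : AltPath (c + e) (splice c g (λ j → gp (r + j)))
      spliced = splice-AltPath (take c≤a Q , start) tail (trans (cong gp (+-identityʳ r)) (sym meet))
        λ {_} {j} x<c j≤e meets →
          first x<c (r + j , s≤s (subst (r + j ≤_) r+e≡L (+-monoʳ-≤ r j≤e)) , ≤-trans K≤r (m≤m+n r j) , meets)
      end : splice c g (λ j → gp (r + j)) (c + e) ≡ gp L
      end = trans (splice-+ c g _ e) (cong gp r+e≡L)
      shorter : c + e < L
      shorter = subst (c + e <_) r+e≡L (+-monoˡ-< e (<-≤-trans c<K K≤r))

    backward : ∀ {a c r g} → AltPath a g → c ≤ a → c < K → K < r → r ≤ L → g c ≡ gp r → (∀ {x} → x < c → ¬ Meets g x) →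
      parity c ≢ parity r → ⊥
    backward {c = c} {r} {g} (Q , start) c≤a c<K K<r r≤L meet first c≢r with m≤n⇒∃[o]m+o≡n K<r
    ... | d , 1+K+d≡r = <⇒≱ short (long-pair spliced end (take K<L (proj₁ p) , proj₂ p) refl odd)
      where
      h : ℕ → Fin n
      h j = gp (suc K + (d ∸ j))
      offset : parity (suc (suc K + d)) ≡ parity c
      offset = trans (cong (not ∘ parity) 1+K+d≡r) (sym (¬-not c≢r))
      segment : AltSegment c d h
      segment = reoffset offset
        (reverse (drop (suc K) (subst (λ l → AltSegment 0 l gp) (sym 1+K+d≡r) (take r≤L (proj₁ p)))))
      spliced : AltPath (c + d) (splice c g h)
      spliced = splice-AltPath (take c≤a Q , start) segment (trans (cong gp 1+K+d≡r) (sym meet))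
        λ {_} {j} x<c _ meets →
          first x<c ( suc K + (d ∸ j)
                    , s≤s (≤-trans (+-monoʳ-≤ (suc K) (m∸n≤m d j)) (subst (_≤ L) (sym 1+K+d≡r) r≤L))
                    , ≤-trans (n≤1+n K) (m≤m+n (suc K) (d ∸ j)) , meets)
      end : splice c g h (c + d) ≡ gp (suc K)
      end = trans (splice-+ c g h d) (cong gp (trans (cong (suc K +_) (n∸n≡0 d)) (+-identityʳ (suc K))))
      lengths : c + d + suc K ≡ c + r
      lengths = trans (+-assoc c d (suc K)) (cong (c +_) (trans (+-comm d (suc K)) 1+K+d≡r))
      odd : parity (c + d + suc K) ≡ true
      odd = trans (cong parity lengths) (parity-+-≢ {c} {r} c≢r)
      short : c + d + suc K < L + L
      short = subst (_< L + L) (sym lengths) (+-mono-<-≤ (<-trans c<K K<L) r≤L)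

    no-detour : ∀ {a g} → AltPath a g → g a ≡ gp K → parity a ≡ parity K → a < K → ⊥
    no-detour {a} {g} q@(Q , _) end same a<K with least-witness (meets? g) (K , s≤s (<⇒≤ K<L) , ≤-refl , end)
    ... | c , c≤a , (r , r<1+L , K≤r , meet) , first with parity c ≟ᵇ parity r
    ...   | yes c≡r = forward q c≤a (≤-<-trans c≤a a<K) K≤r (s≤s⁻¹ r<1+L) meet first c≡r
    ...   | no  c≢r = backward q c≤a (≤-<-trans c≤a a<K) (≤∧≢⇒< K≤r K≢r) (s≤s⁻¹ r<1+L) meet first c≢r
      where
      -- Meeting p at K itself would make c = a, of the same parity as K.
      K≢r : K ≢ r
      K≢r K≡r = c≢r (begin
        parity c ≡⟨ cong parity (injective Q c≤a ≤-refl (trans meet (trans (cong gp (sym K≡r)) (sym end)))) ⟩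
        parity a ≡⟨ same ⟩
        parity K ≡⟨ cong parity K≡r ⟩
        parity r ∎)
        where open ≡-Reasoning

    prefix-shortest : ∀ {a g} → AltPath a g → g a ≡ gp K → parity a ≡ parity K → K ≤ a
    prefix-shortest {a} q end same with K ≤? a
    ... | yes K≤a = K≤a
    ... | no  K≰a = contradiction (≰⇒> K≰a) (no-detour q end same)

honest-before-equal-tenacity : ∀ {n} (G : Graph n) (M : Matching G) {v t L p} →
  Tenacity G M v (fin t) → MinLevelPath G M L p v →
  (i : Fin L) → Tenacity G M (p (fsuc i)) (fin t) → BFSHonest G M L p (inject₁ i)
honest-before-equal-tenacity G M {v} {L = L} {p} tenacity-v (path , minlevel) i tenacity-w =
  shortest⇒BFSHonest G M {p = p} prefix λ path′ same →
    prefix-shortest G M gpath K<L shortest-to-end long-pair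
      (FreeAltPath⇒AltPath G M path′) (trans (FreeAltPath-end G M path′) (sym at-K)) same
  where
  gp : ℕ → Fin _
  gp = p ∘ clamp L
  gpath : AltPath G M L gp
  gpath = FreeAltPath⇒AltPath G M path
  K : ℕ
  K = toℕ (inject₁ i)
  K<L : K < L
  K<L = subst (_< L) (sym (toℕ-inject₁ i)) (toℕ<n i)
  at-K : gp K ≡ p (inject₁ i)
  at-K = cong p (clamp-toℕ (inject₁ i))
  at-1+K : gp (suc K) ≡ p (fsuc i)
  at-1+K = cong p (trans (cong (clamp L ∘ suc) (toℕ-inject₁ i)) (clamp-toℕ (fsuc i)))
  at-L : gp L ≡ v
  at-L = FreeAltPath-end G M path
  prefix : FreeAltPath G M K (gp ∘ toℕ) (p (inject₁ i))
  prefix = AltPath⇒FreeAltPath G M (take G M (<⇒≤ K<L) (proj₁ gpath) , proj₂ gpath) at-K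
  shortest-to-end : ∀ {l g} → AltPath G M l g → g l ≡ gp L → L ≤ l
  shortest-to-end q end = minLevel-≤ G M minlevel (AltPath⇒FreeAltPath G M q (trans end at-L))
  long-pair : ∀ {x y g h} → AltPath G M x g → g x ≡ gp (suc K) → AltPath G M y h → h y ≡ gp (suc K) →
    parity (x + y) ≡ true → L + L ≤ x + y
  long-pair q end q′ end′ odd = ≤-trans (minLevel+minLevel≤tenacity G M minlevel tenacity-v)
    (tenacity-≤ G M tenacity-w (AltPath⇒FreeAltPath G M q (trans end at-1+K))
                               (AltPath⇒FreeAltPath G M q′ (trans end′ at-1+K)) odd)

lemma6p6 : {n : ℕ} (G : Graph n) (M : Matching G)
    (v : Fin n) (t : ℕ) → Tenacity G M v (fin t) → Eligible G M t →
    (L : ℕ) (p : Fin (suc L) → Fin n) → MinLevelPath G M L p v →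
    (b : Fin (suc L)) → IsF G M L p t b →
    (i : Fin L) → toℕ b ≤ toℕ i → TenLt G M (p (inject₁ i)) t →
    Tenacity G M (p (fsuc i)) (fin t) →
    BFSHonest G M L p (inject₁ i)
lemma6p6 G M v t tenacity-v _ L p minlevel-path _ _ i _ _ tenacity-w =
  honest-before-equal-tenacity G M tenacity-v minlevel-path i tenacity-w
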